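{- Let $d$ be a constant nonnegative integer, $V$ a finite set with $n=|V|$, and $f:2^V\to\{0,1,\dots,d\}$ a posimodular function with $f(\emptyset)=0$, such that every maximal maximizer $X^*$ of $f$ satisfies $|X^*|=n-d$ and $f(X^*)=d$. Let $\mathcal{X}$ be the family of all subsets $X\subseteq V$ with $|X|=d-1$ such that $X\cap S\ne\emptyset$ for every maximizer $S$ of $f$ with $|S|=d$. Then $|\mathcal{X}|=O(n^{d-3})$.
   Context: A set function $f:2^V\to\mathbb{R}$ is posimodular if $f(X)+f(Y)\ge f(X\setminus Y)+f(Y\setminus X)$ for all $X,Y\subseteq V$. A maximizer of $f$ is a subset $S\subseteq V$ with $f(S)=\max\{f(X)\mid X\subseteq V\}$; it is a maximal maximizer if no proper superset of $S$ is a maximizer of $f$. The $O(\cdot)$ is as $n\to\infty$ with $d$ fixed. -}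

module Defs where

open import Data.Nat using (ℕ; _+_; _≤_)
open import Data.Product using (_×_)
open import Data.Fin.Subset using (Subset; _─_; _⊂_; _∩_; ∣_∣; Nonempty)
open import Relation.Nullary using (¬_)
open import Relation.Binary.PropositionalEquality using (_≡_)

Posimodular : ∀ {n} → (Subset n → ℕ) → Set
Posimodular f = ∀ X Y → f (X ─ Y) + f (Y ─ X) ≤ f X + f Y

Maximizer : ∀ {n} → (Subset n → ℕ) → Subset n → Set
Maximizer f S = ∀ X → f X ≤ f S

MaximalMaximizer : ∀ {n} → (Subset n → ℕ) → Subset n → Set
MaximalMaximizer f S = Maximizer f S × (∀ T → S ⊂ T → ¬ Maximizer f T)

-- Membership in the family 𝒳: |X| = d - 1 (written |X| + 1 = d, so
-- the family is empty when d = 0), and X meets every maximizer S of f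
-- with |S| = d.
InFamily : ∀ {n} → ℕ → (Subset n → ℕ) → Subset n → Set
InFamily d f X =
  (∣ X ∣ + 1 ≡ d) × (∀ S → Maximizer f S → ∣ S ∣ ≡ d → Nonempty (X ∩ S))

-- Let M be a maximal maximizer. Adding one point u ∉ M strictly lowers f, so posimodularity
-- applied to M ∪ {u} and any Q disjoint from M gives f (Q - u) < f Q; hence f Q ≥ |Q|. In
-- particular the d-element complement of M is itself a maximizer. Taking a maximal maximizer
-- M₀, then a maximal maximizer M₁ ⊇ ∁ M₀, yields two disjoint maximizers ∁ M₀ and ∁ M₁ of
-- size d, and every member of the family meets both. So each member has two of its d - 1 points
-- in a fixed set of size ≤ 2d, and there are at most (2d)² n^(d-3) such sets.
module Submission where

open import Defs
open import Data.Bool.Base using (Bool)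
open import Data.Bool.Properties using () renaming (_≟_ to _≟ᵇ_)
open import Data.Empty using (⊥-elim)
open import Data.Fin.Base using (Fin)
open import Data.Fin.Subset
  using (Subset; ⊥; ∣_∣; _∩_; _∪_; _─_; _-_; ∁; ⁅_⁆; _∈_; _∉_; _⊆_; _⊂_; _⊃_; Nonempty; inside; outside)
open import Data.Fin.Subset.Induction using (Acc; acc; ⊂-wellFounded; ⊃-wellFounded)
open import Data.Fin.Subset.Properties
open import Data.List.Base using (List; []; _∷_; length)
open import Data.List.Relation.Unary.All as All using (All; []; _∷_)
open import Data.List.Relation.Unary.AllPairs using ([]; _∷_)
open import Data.List.Relation.Unary.Unique.Propositional using (Unique)
open import Data.Nat.Base
  using (ℕ; zero; suc; _+_; _*_; _^_; _∸_; _≤_; _<_; _≥_; z≤n; s≤s; s≤s⁻¹)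
open import Data.Nat.Properties
open import Data.Product using (Σ; ∃; _×_; _,_; proj₁; proj₂)
open import Data.Sum using ([_,_]′)
open import Data.Vec.Base using ([]; _∷_; here; there)
open import Function.Base using (_∘_)
open import Relation.Binary.PropositionalEquality
open import Relation.Nullary using (¬_; yes; no)
open import Relation.Nullary.Decidable using (_×-dec_; ¬?; map′)
open import Relation.Unary using (Decidable)

private
  variable
    n : ℕ

x∈p⇒∣p∣≡1+∣p-x∣ : ∀ {x : Fin n} {p : Subset n} → x ∈ p → ∣ p ∣ ≡ suc ∣ p - x ∣
x∈p⇒∣p∣≡1+∣p-x∣ {p = inside ∷ p}  here        = cong (λ q → suc ∣ q ∣) (sym (p─⊥≡p p))
x∈p⇒∣p∣≡1+∣p-x∣ {p = inside ∷ p}  (there x∈p) = cong suc (x∈p⇒∣p∣≡1+∣p-x∣ x∈p)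
x∈p⇒∣p∣≡1+∣p-x∣ {p = outside ∷ p} (there x∈p) = x∈p⇒∣p∣≡1+∣p-x∣ x∈p

x∈p∧y∈p∧x≢y⇒2≤∣p∣ : ∀ {x y : Fin n} {p : Subset n} → x ∈ p → y ∈ p → x ≢ y → 2 ≤ ∣ p ∣
x∈p∧y∈p∧x≢y⇒2≤∣p∣ x∈p y∈p x≢y
  rewrite x∈p⇒∣p∣≡1+∣p-x∣ x∈p
        | x∈p⇒∣p∣≡1+∣p-x∣ (x∈p∧x≢y⇒x∈p-y y∈p (x≢y ∘ sym)) = s≤s (s≤s z≤n)

∣p∪q∣≤∣p∣+∣q∣ : ∀ (p q : Subset n) → ∣ p ∪ q ∣ ≤ ∣ p ∣ + ∣ q ∣
∣p∪q∣≤∣p∣+∣q∣ []            []            = z≤n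
∣p∪q∣≤∣p∣+∣q∣ (inside ∷ p)  (s ∷ q)       =
  s≤s (≤-trans (∣p∪q∣≤∣p∣+∣q∣ p q) (+-monoʳ-≤ ∣ p ∣ (∣p∣≤∣x∷p∣ s q)))
∣p∪q∣≤∣p∣+∣q∣ (outside ∷ p) (inside ∷ q)  =
  ≤-trans (s≤s (∣p∪q∣≤∣p∣+∣q∣ p q)) (≤-reflexive (sym (+-suc ∣ p ∣ ∣ q ∣)))
∣p∪q∣≤∣p∣+∣q∣ (outside ∷ p) (outside ∷ q) = ∣p∪q∣≤∣p∣+∣q∣ p q

x∈p─q⇒x∉q : ∀ {x : Fin n} (p q : Subset n) → x ∈ p ─ q → x ∉ q
x∈p─q⇒x∉q (_ ∷ p) (outside ∷ q) here        ()
x∈p─q⇒x∉q (_ ∷ p) (_ ∷ q)       (there x∈) (there x∈q) = x∈p─q⇒x∉q p q x∈ x∈q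

p⊆∁q⇒p─q≡p : ∀ {p q : Subset n} → p ⊆ ∁ q → p ─ q ≡ p
p⊆∁q⇒p─q≡p {p = p} {q} p⊆∁q =
  ⊆-antisym (p─q⊆p p q) (λ x∈p → x∈p∧x∉q⇒x∈p─q x∈p (x∈∁p⇒x∉p (p⊆∁q x∈p)))


meets-A∧meets-∁B⇒2≤∣X∩[A∪∁B]∣ : ∀ {X A B : Subset n} → A ⊆ B →
  Nonempty (X ∩ A) → Nonempty (X ∩ ∁ B) → 2 ≤ ∣ X ∩ (A ∪ ∁ B) ∣
meets-A∧meets-∁B⇒2≤∣X∩[A∪∁B]∣ {X = X} {A} {B} A⊆B (x , x∈X∩A) (y , y∈X∩∁B) =
  let x∈X , x∈A  = x∈p∩q⁻ X A x∈X∩A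
      y∈X , y∈∁B = x∈p∩q⁻ X (∁ B) y∈X∩∁B
  in x∈p∧y∈p∧x≢y⇒2≤∣p∣ (x∈p∩q⁺ (x∈X , p⊆p∪q (∁ B) x∈A)) (x∈p∩q⁺ (y∈X , q⊆p∪q A (∁ B) y∈∁B))
       (λ { refl → x∈∁p⇒x∉p y∈∁B (A⊆B x∈A) })

p⊆∁q⇒p─[q∪⁅x⁆]≡p-x : ∀ {p q : Subset n} {x} → p ⊆ ∁ q → p ─ (q ∪ ⁅ x ⁆) ≡ p - x
p⊆∁q⇒p─[q∪⁅x⁆]≡p-x {p = p} {q} {x} p⊆∁q = begin
  p ─ (q ∪ ⁅ x ⁆)  ≡⟨ p─q─r≡p─q∪r p q ⁅ x ⁆ ⟨
  p ─ q - x        ≡⟨ cong (_- x) (p⊆∁q⇒p─q≡p p⊆∁q) ⟩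
  p - x            ∎
  where open ≡-Reasoning

p⊆∁q∧x∈p⇒[q∪⁅x⁆]─p≡q : ∀ {p q : Subset n} {x} → p ⊆ ∁ q → x ∈ p → (q ∪ ⁅ x ⁆) ─ p ≡ q
p⊆∁q∧x∈p⇒[q∪⁅x⁆]─p≡q {p = p} {q} {x} p⊆∁q x∈p = ⊆-antisym ⊆q q⊆
  where
  ⊆q : (q ∪ ⁅ x ⁆) ─ p ⊆ q
  ⊆q {y} y∈ = [ (λ y∈q → y∈q) , (λ y∈⁅x⁆ → ⊥-elim (y∉p (subst (_∈ p) (sym (x∈⁅y⁆⇒x≡y x y∈⁅x⁆)) x∈p))) ]′
                (x∈p∪q⁻ q ⁅ x ⁆ (p─q⊆p (q ∪ ⁅ x ⁆) p y∈))
    where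
    y∉p : y ∉ p
    y∉p = x∈p─q⇒x∉q (q ∪ ⁅ x ⁆) p y∈
  q⊆ : q ⊆ (q ∪ ⁅ x ⁆) ─ p
  q⊆ y∈q = x∈p∧x∉q⇒x∈p─q (p⊆p∪q ⁅ x ⁆ y∈q) (λ y∈p → x∈∁p⇒x∉p (p⊆∁q y∈p) y∈q)


tailsWith : Bool → List (Subset (suc n)) → List (Subset n)
tailsWith b []             = []
tailsWith b ((c ∷ X) ∷ Xs) with c ≟ᵇ b
... | yes _ = X ∷ tailsWith b Xs
... | no  _ = tailsWith b Xs

length-tailsWith : (Xs : List (Subset (suc n))) →
                   length Xs ≡ length (tailsWith inside Xs) + length (tailsWith outside Xs)
length-tailsWith []                   = refl
length-tailsWith ((inside ∷ X) ∷ Xs)  = cong suc (length-tailsWith Xs)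
length-tailsWith ((outside ∷ X) ∷ Xs) =
  trans (cong suc (length-tailsWith Xs)) (sym (+-suc _ _))

All-tailsWith : ∀ b {P : Subset (suc n) → Set} {Xs} → All P Xs → All (λ X → P (b ∷ X)) (tailsWith b Xs)
All-tailsWith b {Xs = []}           []       = []
All-tailsWith b {Xs = (c ∷ X) ∷ Xs} (p ∷ ps) with c ≟ᵇ b
... | yes refl = p ∷ All-tailsWith b ps
... | no  _    = All-tailsWith b ps

Unique-tailsWith : ∀ b {Xs : List (Subset (suc n))} → Unique Xs → Unique (tailsWith b Xs)
Unique-tailsWith b {[]}           []         = []
Unique-tailsWith b {(c ∷ X) ∷ Xs} (X∉Xs ∷ u) with c ≟ᵇ b
... | yes refl = All.map (λ bX≢bY X≡Y → bX≢bY (cong (b ∷_) X≡Y)) (All-tailsWith b X∉Xs)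
                 ∷ Unique-tailsWith b u
... | no  _    = Unique-tailsWith b u

All-unsatisfiable⇒≡[] : ∀ {A : Set} {P : A → Set} {xs : List A} → All P xs → (∀ x → ¬ P x) → xs ≡ []
All-unsatisfiable⇒≡[] []      _  = refl
All-unsatisfiable⇒≡[] (p ∷ _) ¬P = ⊥-elim (¬P _ p)

c*x^a+c*x^[1+a]≤c*[1+x]^[1+a] : ∀ c x a → c * x ^ a + c * x ^ suc a ≤ c * suc x ^ suc a
c*x^a+c*x^[1+a]≤c*[1+x]^[1+a] c x a = begin
  c * x ^ a + c * (x * x ^ a)  ≡⟨ *-distribˡ-+ c (x ^ a) (x * x ^ a) ⟨
  c * (suc x * x ^ a)          ≤⟨ *-monoʳ-≤ c (*-monoʳ-≤ (suc x) (^-monoˡ-≤ a (n≤1+n x))) ⟩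
  c * (suc x * suc x ^ a)      ∎
  where open ≤-Reasoning

x^j*y^a+x^[1+j]*y^a≤[1+x]^[1+j]*[1+y]^a : ∀ x j y a →
  x ^ j * y ^ a + x ^ suc j * y ^ a ≤ suc x ^ suc j * suc y ^ a
x^j*y^a+x^[1+j]*y^a≤[1+x]^[1+j]*[1+y]^a x j y a = begin
  x ^ j * y ^ a + x * x ^ j * y ^ a  ≡⟨ cong (x ^ j * y ^ a +_) (*-assoc x (x ^ j) (y ^ a)) ⟩
  suc x * (x ^ j * y ^ a)            ≤⟨ *-monoʳ-≤ (suc x)
                                          (*-mono-≤ (^-monoˡ-≤ j (n≤1+n x)) (^-monoˡ-≤ a (n≤1+n y))) ⟩
  suc x * (suc x ^ j * suc y ^ a)    ≡⟨ *-assoc (suc x) (suc x ^ j) (suc y ^ a) ⟨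
  suc x ^ suc j * suc y ^ a          ∎
  where open ≤-Reasoning

LargeTrace : ℕ → ℕ → Subset n → Subset n → Set
LargeTrace j a K X = ∣ X ∣ ≡ j + a × j ≤ ∣ X ∩ K ∣

length≤-tailsWith : ∀ {p q r} (Xs : List (Subset (suc n))) →
  length (tailsWith inside Xs) ≤ p → length (tailsWith outside Xs) ≤ q → p + q ≤ r → length Xs ≤ r
length≤-tailsWith Xs ins outs p+q≤r =
  ≤-trans (≤-reflexive (length-tailsWith Xs)) (≤-trans (+-mono-≤ ins outs) p+q≤r)

-- A set is determined by its first coordinate and its tail; recursing on the coordinates,
-- each of the j trace points is chosen among those of K and each of the other a points anywhere.
length≤∣K∣^j*n^a : ∀ j a (K : Subset n) {Xs : List (Subset n)} →
  Unique Xs → All (LargeTrace j a K) Xs → length Xs ≤ ∣ K ∣ ^ j * n ^ a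
length≤∣K∣^j*n^a j       a       [] {[]}          _ _ = z≤n
length≤∣K∣^j*n^a zero    zero    [] {[] ∷ []}     _ _ = ≤-refl
length≤∣K∣^j*n^a (suc j) a       [] {[] ∷ _}      _ ((() , _) ∷ _)
length≤∣K∣^j*n^a zero    (suc a) [] {[] ∷ _}      _ ((() , _) ∷ _)
length≤∣K∣^j*n^a j       a       [] {[] ∷ [] ∷ _} ((≢ ∷ _) ∷ _) _ = ⊥-elim (≢ refl)
length≤∣K∣^j*n^a {suc n} (suc j) a (inside ∷ K) {Xs} u large =
  length≤-tailsWith Xs
    (length≤∣K∣^j*n^a j a K (Unique-tailsWith inside u)
      (All.map (λ (size , trace) → suc-injective size , s≤s⁻¹ trace) (All-tailsWith inside large)))
    (length≤∣K∣^j*n^a (suc j) a K (Unique-tailsWith outside u) (All-tailsWith outside large))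
    (x^j*y^a+x^[1+j]*y^a≤[1+x]^[1+j]*[1+y]^a ∣ K ∣ j n a)
length≤∣K∣^j*n^a {suc n} zero (suc a) (inside ∷ K) {Xs} u large =
  length≤-tailsWith Xs
    (length≤∣K∣^j*n^a zero a K (Unique-tailsWith inside u)
      (All.map (λ (size , _) → suc-injective size , z≤n) (All-tailsWith inside large)))
    (length≤∣K∣^j*n^a zero (suc a) K (Unique-tailsWith outside u) (All-tailsWith outside large))
    (c*x^a+c*x^[1+a]≤c*[1+x]^[1+a] 1 n a)
length≤∣K∣^j*n^a {suc n} zero zero (inside ∷ K) {Xs} u large =
  length≤-tailsWith Xs
    (≤-reflexive (cong length (All-unsatisfiable⇒≡[] (All-tailsWith inside large) λ _ ())))
    (length≤∣K∣^j*n^a zero zero K (Unique-tailsWith outside u) (All-tailsWith outside large))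
    ≤-refl
length≤∣K∣^j*n^a {suc n} j (suc a) (outside ∷ K) {Xs} u large =
  length≤-tailsWith Xs
    (length≤∣K∣^j*n^a j a K (Unique-tailsWith inside u)
      (All.map (λ (size , trace) → suc-injective (trans size (+-suc j a)) , trace) (All-tailsWith inside large)))
    (length≤∣K∣^j*n^a j (suc a) K (Unique-tailsWith outside u) (All-tailsWith outside large))
    (c*x^a+c*x^[1+a]≤c*[1+x]^[1+a] (∣ K ∣ ^ j) n a)
length≤∣K∣^j*n^a {suc n} j zero (outside ∷ K) {Xs} u large =
  length≤-tailsWith Xs
    (≤-reflexive (cong length (All-unsatisfiable⇒≡[] (All-tailsWith inside large) too-small)))
    (length≤∣K∣^j*n^a j zero K (Unique-tailsWith outside u) (All-tailsWith outside large))
    ≤-refl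
  where
  too-small : ∀ X → ¬ LargeTrace j zero (outside ∷ K) (inside ∷ X)
  too-small X (size , trace) =
    1+n≰n (≤-trans (≤-reflexive (trans size (+-identityʳ j))) (≤-trans trace (∣p∩q∣≤∣p∣ X K)))

length*n^3≤m^2*n^[3+a] : ∀ {m a} {K : Subset n} {Xs} → ∣ K ∣ ≤ m → Unique Xs →
  All (λ X → ∣ X ∣ ≡ 2 + a × 2 ≤ ∣ X ∩ K ∣) Xs → length Xs * n ^ 3 ≤ m ^ 2 * n ^ (3 + a)
length*n^3≤m^2*n^[3+a] {n} {m} {a} {K} {Xs} ∣K∣≤m u large = begin
  length Xs * n ^ 3      ≤⟨ *-monoˡ-≤ (n ^ 3) (length≤∣K∣^j*n^a 2 a K u large) ⟩
  ∣ K ∣ ^ 2 * n ^ a * n ^ 3 ≤⟨ *-monoˡ-≤ (n ^ 3) (*-monoˡ-≤ (n ^ a) (^-monoˡ-≤ 2 ∣K∣≤m)) ⟩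
  m ^ 2 * n ^ a * n ^ 3  ≡⟨ *-assoc (m ^ 2) (n ^ a) (n ^ 3) ⟩
  m ^ 2 * (n ^ a * n ^ 3) ≡⟨ cong (m ^ 2 *_) (^-distribˡ-+-* n a 3) ⟨
  m ^ 2 * n ^ (a + 3)    ≡⟨ cong (λ e → m ^ 2 * n ^ e) (+-comm a 3) ⟩
  m ^ 2 * n ^ (3 + a)    ∎
  where open ≤-Reasoning

length*n^3≤m^2*n^d : ∀ {m d} {K : Subset n} {Xs} → ∣ K ∣ ≤ m → Unique Xs →
  All (λ X → ∣ X ∣ + 1 ≡ d × 2 ≤ ∣ X ∩ K ∣) Xs → length Xs * n ^ 3 ≤ m ^ 2 * n ^ d
length*n^3≤m^2*n^d {Xs = []} _ _ _ = z≤n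
length*n^3≤m^2*n^d {K = K} {Xs = X ∷ _} ∣K∣≤m u all@((size , two) ∷ _)
  with subst (3 ≤_) size (+-monoˡ-≤ 1 (≤-trans two (∣p∩q∣≤∣p∣ X K)))
... | s≤s (s≤s (s≤s _)) = length*n^3≤m^2*n^[3+a] ∣K∣≤m u
  (All.map (λ {Y} (size , two) → suc-injective (trans (+-comm 1 ∣ Y ∣) size) , two) all)


module _ (f : Subset n → ℕ) where

  maximizer? : Decidable (Maximizer f)
  maximizer? S = map′
    (λ ∄X X → ≮⇒≥ (λ fS<fX → ∄X (X , fS<fX)))
    (λ maxS (X , fS<fX) → <⇒≱ fS<fX (maxS X))
    (¬? (anySubset? (λ X → f S <? f X)))

  maximal-extension : ∀ D → Maximizer f D → ∃ λ M → MaximalMaximizer f M × D ⊆ M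
  maximal-extension D = go D (⊃-wellFounded D)
    where
    go : ∀ D → Acc _⊃_ D → Maximizer f D → ∃ λ M → MaximalMaximizer f M × D ⊆ M
    go D (acc rec) maxD with anySubset? (λ T → (D ⊂? T) ×-dec maximizer? T)
    ... | no ∄T = D , (maxD , λ T D⊂T maxT → ∄T (T , D⊂T , maxT)) , ⊆-refl
    ... | yes (T , D⊂T , maxT) =
      let M , maximalM , T⊆M = go T (rec D⊂T) maxT in M , maximalM , ⊆-trans (p⊂q⇒p⊆q D⊂T) T⊆M

maximizer-exists : (f : Subset n → ℕ) → ∃ (Maximizer f)
maximizer-exists {zero}  f = [] , λ { [] → ≤-refl }
maximizer-exists {suc n} f
  with maximizer-exists (λ X → f (inside ∷ X)) | maximizer-exists (λ X → f (outside ∷ X))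
... | S₁ , max₁ | S₀ , max₀ with f (inside ∷ S₁) ≤? f (outside ∷ S₀)
...   | yes ≤₀ = outside ∷ S₀ , λ { (inside ∷ X) → ≤-trans (max₁ X) ≤₀ ; (outside ∷ X) → max₀ X }
...   | no  ≰₀ = inside ∷ S₁ , λ { (inside ∷ X) → max₁ X ; (outside ∷ X) → ≤-trans (max₀ X) (≰⇒≥ ≰₀) }


module _ {f : Subset n → ℕ} (posimodular : Posimodular f)
         {M : Subset n} (maximal : MaximalMaximizer f M) where

  private
    maxM : Maximizer f M
    maxM = proj₁ maximal

  f[M∪⁅u⁆]<f[M] : ∀ {u} → u ∉ M → f (M ∪ ⁅ u ⁆) < f M
  f[M∪⁅u⁆]<f[M] {u} u∉M = ≤∧≢⇒< (maxM _) λ f[M∪u]≡f[M] →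
    proj₂ maximal (M ∪ ⁅ u ⁆) M⊂M∪u (λ X → subst (f X ≤_) (sym f[M∪u]≡f[M]) (maxM X))
    where
    M⊂M∪u : M ⊂ M ∪ ⁅ u ⁆
    M⊂M∪u = p⊆p∪q ⁅ u ⁆ , u , q⊆p∪q M ⁅ u ⁆ (x∈⁅x⁆ u) , u∉M

  f[Q-u]<f[Q] : ∀ {Q u} → Q ⊆ ∁ M → u ∈ Q → f (Q - u) < f Q
  f[Q-u]<f[Q] {Q} {u} Q⊆∁M u∈Q = +-cancelˡ-< (f M) (f (Q - u)) (f Q) (begin-strict
    f M + f (Q - u)                            ≡⟨ cong₂ (λ A B → f A + f B) (p⊆∁q∧x∈p⇒[q∪⁅x⁆]─p≡q Q⊆∁M u∈Q)
                                                                           (p⊆∁q⇒p─[q∪⁅x⁆]≡p-x Q⊆∁M) ⟨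
    f ((M ∪ ⁅ u ⁆) ─ Q) + f (Q ─ (M ∪ ⁅ u ⁆))  ≤⟨ posimodular (M ∪ ⁅ u ⁆) Q ⟩
    f (M ∪ ⁅ u ⁆) + f Q                        <⟨ +-monoˡ-< (f Q) (f[M∪⁅u⁆]<f[M] (x∈∁p⇒x∉p (Q⊆∁M u∈Q))) ⟩
    f M + f Q                                  ∎)
    where open ≤-Reasoning

  ∣Q∣≤f[Q] : ∀ {Q} → Q ⊆ ∁ M → ∣ Q ∣ ≤ f Q
  ∣Q∣≤f[Q] {Q} = go Q (⊂-wellFounded Q)
    where
    go : ∀ Q → Acc _⊂_ Q → Q ⊆ ∁ M → ∣ Q ∣ ≤ f Q
    go Q (acc rec) Q⊆∁M with nonempty? Q
    ... | no  empty     = ≤-trans (≤-reflexive (trans (cong ∣_∣ (Empty-unique empty)) (∣⊥∣≡0 n))) z≤n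
    ... | yes (u , u∈Q) = begin
      ∣ Q ∣          ≡⟨ x∈p⇒∣p∣≡1+∣p-x∣ u∈Q ⟩
      suc ∣ Q - u ∣  ≤⟨ s≤s (go (Q - u) (rec (x∈p⇒p-x⊂p u∈Q)) (⊆-trans (p─q⊆p Q ⁅ u ⁆) Q⊆∁M)) ⟩
      suc (f (Q - u)) ≤⟨ f[Q-u]<f[Q] Q⊆∁M u∈Q ⟩
      f Q            ∎
      where open ≤-Reasoning

  ∁-maximizer : f M ≤ ∣ ∁ M ∣ → Maximizer f (∁ M)
  ∁-maximizer f[M]≤∣∁M∣ X = ≤-trans (maxM X) (≤-trans f[M]≤∣∁M∣ (∣Q∣≤f[Q] ⊆-refl))


module _ {d : ℕ} {f : Subset n → ℕ} (posimodular : Posimodular f)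
         (shape : ∀ M → MaximalMaximizer f M → (∣ M ∣ + d ≡ n) × (f M ≡ d)) where

  ∣∁M∣≡d : ∀ {M} → MaximalMaximizer f M → ∣ ∁ M ∣ ≡ d
  ∣∁M∣≡d {M} maximal = begin
    ∣ ∁ M ∣            ≡⟨ ∣∁p∣≡n∸∣p∣ M ⟩
    n ∸ ∣ M ∣          ≡⟨ cong (_∸ ∣ M ∣) (proj₁ (shape M maximal)) ⟨
    ∣ M ∣ + d ∸ ∣ M ∣  ≡⟨ m+n∸m≡n ∣ M ∣ d ⟩
    d                  ∎
    where open ≡-Reasoning

  ∁-maximal⇒maximizer : ∀ {M} → MaximalMaximizer f M → Maximizer f (∁ M)
  ∁-maximal⇒maximizer {M} maximal =
    ∁-maximizer posimodular maximal (≤-reflexive (trans (proj₂ (shape M maximal)) (sym (∣∁M∣≡d maximal))))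

  family-has-two-point-trace : ∃ λ K → ∣ K ∣ ≤ d + d × (∀ X → InFamily d f X → 2 ≤ ∣ X ∩ K ∣)
  family-has-two-point-trace =
    let S , maxS = maximizer-exists f
        M₀ , maximal₀ , _ = maximal-extension f S maxS
        M₁ , maximal₁ , ∁M₀⊆M₁ = maximal-extension f (∁ M₀) (∁-maximal⇒maximizer maximal₀)
        meets-∁ : ∀ {X M} → InFamily d f X → MaximalMaximizer f M → Nonempty (X ∩ ∁ M)
        meets-∁ (_ , meets) maximal = meets _ (∁-maximal⇒maximizer maximal) (∣∁M∣≡d maximal)
    in ∁ M₀ ∪ ∁ M₁
     , ≤-trans (∣p∪q∣≤∣p∣+∣q∣ (∁ M₀) (∁ M₁)) (≤-reflexive (cong₂ _+_ (∣∁M∣≡d maximal₀) (∣∁M∣≡d maximal₁)))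
     , λ X inX → meets-A∧meets-∁B⇒2≤∣X∩[A∪∁B]∣ ∁M₀⊆M₁ (meets-∁ inX maximal₀) (meets-∁ inX maximal₁)

lemma17 : (d : ℕ) → Σ ℕ λ C → Σ ℕ λ N → (n : ℕ) → n ≥ N →
    (f : Subset n → ℕ) → (∀ X → f X ≤ d) → Posimodular f → f ⊥ ≡ 0 →
    (∀ X → MaximalMaximizer f X → (∣ X ∣ + d ≡ n) × (f X ≡ d)) →
    (L : List (Subset n)) → Unique L → All (InFamily d f) L →
    length L * n ^ 3 ≤ C * n ^ d
lemma17 d = (d + d) ^ 2 , 0 , λ n _ f _ posimodular _ shape L unique family →
  let K , ∣K∣≤2d , two-point-trace = family-has-two-point-trace posimodular shape
  in length*n^3≤m^2*n^d ∣K∣≤2d unique (All.map (λ {X} inX → proj₁ inX , two-point-trace X inX) family)
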